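{- Let $G$ be a finite abelian group of order $n$ (written additively, identity $0$), and define $d^*(G)$ to be the maximum integer $d$ for which there exist symmetric subsets $S,T\subseteq G\setminus\{0\}$ with $|S|=|T|=d$ and $N_{S,T}(u)\le 1$ for all $u\in G$. Then $d^*(G)\le\lfloor\sqrt n\rfloor$.
   Context: A subset $X$ is symmetric if $-X=X$. $N_{S,T}(u):=|\{(s,t)\in S\times T: s+t=u\}|$. -}

module Defs where

open import Data.Nat using (ℕ; zero; suc; _*_; _≤_; _≤ᵇ_)
open import Data.Bool using (Bool; true; false; _∧_; if_then_else_)
open import Data.Fin using (Fin; _≟_)
open import Data.Fin.Subset using (Subset; _∈_; _∉_; ∣_∣)
open import Data.Vec using (lookup)
open import Data.List using (map; allFin)
open import Data.Nat.ListAction using (sum)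
open import Data.Product using (_×_; ∃₂)
open import Relation.Nullary.Decidable using (⌊_⌋)
open import Relation.Binary.PropositionalEquality using (_≡_)
open import Algebra.Core using (Op₁; Op₂)
open import Algebra.Structures using (IsAbelianGroup)

⌊√_⌋ : ℕ → ℕ
⌊√ zero ⌋ = zero
⌊√ suc n ⌋ with ⌊√ n ⌋
... | r = if (suc r * suc r) ≤ᵇ suc n then suc r else r

module _ {n : ℕ} (_+_ : Op₂ (Fin n)) (0# : Fin n) (-_ : Op₁ (Fin n)) where

  Symmetric : Subset n → Set
  Symmetric X = ∀ x → (x ∈ X → (- x) ∈ X) × ((- x) ∈ X → x ∈ X)

  N : Subset n → Subset n → Fin n → ℕ
  N S T u = sum (map (λ s → sum (map (λ t →
              if lookup S s ∧ lookup T t ∧ ⌊ (s + t) ≟ u ⌋ then 1 else 0)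
              (allFin n))) (allFin n))

  -- d is attained in the definition of d*(G)
  Admissible : ℕ → Set
  Admissible d = ∃₂ λ (S T : Subset n) →
      Symmetric S × Symmetric T × 0# ∉ S × 0# ∉ T
    × ∣ S ∣ ≡ d × ∣ T ∣ ≡ d × (∀ u → N S T u ≤ 1)

{-# OPTIONS --safe #-}
-- Counting the pairs (s , t) ∈ S × T according to their sum u = s + t gives
-- |S| |T| = ∑ᵤ N_{S,T}(u) ≤ n · 1, so d² ≤ n whenever d is admissible.
module Submission where

open import Defs
open import Data.Nat using (ℕ; _≤_)
open import Data.Fin using (Fin)
open import Algebra.Core using (Op₁; Op₂)
open import Algebra.Structures using (IsAbelianGroup)
open import Relation.Binary.PropositionalEquality using (_≡_)

open import Data.Bool using (Bool; true; false; _∧_; if_then_else_; T)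
open import Data.Fin using (zero; suc; _≟_)
open import Data.Fin.Subset using (Subset; ∣_∣)
open import Data.List using (map; allFin; tabulate)
open import Data.List.Properties using (map-tabulate)
open import Data.Nat using (zero; suc; _+_; _*_; _<_; _≤ᵇ_; z≤n; s≤s)
open import Data.Nat.Properties
  using (+-*-semiring; +-mono-≤; +-identityʳ; *-identityʳ; *-mono-≤; *-mono-<; n<1+n; ≤-trans; ≤⇒≤ᵇ; ≰⇒>; <⇒≱; _≤?_)
import Data.Nat.ListAction as ListAction
open import Data.Empty using (⊥-elim)
open import Data.Product using (_,_)
open import Data.Vec using ([]; _∷_; lookup)
open import Function using (id)
open import Relation.Nullary.Decidable using (⌊_⌋; yes; no; ⌊⌋-map′)
open import Relation.Binary.PropositionalEquality
  using (refl; sym; trans; cong; cong₂; subst; subst₂; module ≡-Reasoning)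
open import Algebra.Properties.Semiring.Sum +-*-semiring
  using (sum; sum-syntax; sum-cong-≗; sum-replicate-zero; ∑-comm; *-distribˡ-sum; *-distribʳ-sum)

open ≡-Reasoning

sum-map-allFin : ∀ {n} (f : Fin n → ℕ) → ListAction.sum (map f (allFin n)) ≡ ∑[ i < n ] f i
sum-map-allFin f = trans (cong ListAction.sum (map-tabulate id f)) (sum-tabulate f)
  where
  sum-tabulate : ∀ {m} (g : Fin m → ℕ) → ListAction.sum (tabulate g) ≡ sum g
  sum-tabulate {zero}  g = refl
  sum-tabulate {suc m} g = cong (g zero +_) (sum-tabulate (λ i → g (suc i)))

∑-bounded : ∀ {n k} {f : Fin n → ℕ} → (∀ i → f i ≤ k) → ∑[ i < n ] f i ≤ n * k
∑-bounded {zero}  f≤k = z≤n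
∑-bounded {suc n} f≤k = +-mono-≤ (f≤k zero) (∑-bounded (λ i → f≤k (suc i)))

∑*∑ : ∀ {m n} (f : Fin m → ℕ) (g : Fin n → ℕ) →
      (∑[ i < m ] f i) * (∑[ j < n ] g j) ≡ ∑[ i < m ] ∑[ j < n ] (f i * g j)
∑*∑ {m} {n} f g = begin
  (∑[ i < m ] f i) * (∑[ j < n ] g j)  ≡⟨ *-distribʳ-sum (∑[ j < n ] g j) f ⟩
  ∑[ i < m ] (f i * ∑[ j < n ] g j)    ≡⟨ sum-cong-≗ (λ i → *-distribˡ-sum (f i) g) ⟩
  ∑[ i < m ] ∑[ j < n ] (f i * g j)    ∎

𝟙 : Bool → ℕ
𝟙 b = if b then 1 else 0

∑-𝟙-∧ : ∀ {n} (a : Bool) (p : Fin n → Bool) → ∑[ i < n ] 𝟙 (a ∧ p i) ≡ 𝟙 a * ∑[ i < n ] 𝟙 (p i)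
∑-𝟙-∧     true  p = sym (+-identityʳ _)
∑-𝟙-∧ {n} false p = sum-replicate-zero n

∑-𝟙-≟ : ∀ {n} (x : Fin n) → ∑[ u < n ] 𝟙 ⌊ x ≟ u ⌋ ≡ 1
∑-𝟙-≟ {suc n} zero    = cong suc (sum-replicate-zero n)
∑-𝟙-≟ {suc n} (suc x) = trans (sum-cong-≗ (λ u → cong 𝟙 (⌊⌋-map′ _ _ (x ≟ u)))) (∑-𝟙-≟ x)

∣∣≡∑𝟙 : ∀ {n} (S : Subset n) → ∣ S ∣ ≡ ∑[ i < n ] 𝟙 (lookup S i)
∣∣≡∑𝟙 []          = refl
∣∣≡∑𝟙 (true ∷ S)  = cong suc (∣∣≡∑𝟙 S)
∣∣≡∑𝟙 (false ∷ S) = ∣∣≡∑𝟙 S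

module _ {n : ℕ} (_·_ : Op₂ (Fin n)) (0# : Fin n) (-_ : Op₁ (Fin n)) (S T : Subset n) where

  private
    χ : Fin n → Fin n → Fin n → ℕ
    χ s t u = 𝟙 (lookup S s ∧ lookup T t ∧ ⌊ (s · t) ≟ u ⌋)

    N≡∑∑χ : ∀ u → N _·_ 0# -_ S T u ≡ ∑[ s < n ] ∑[ t < n ] χ s t u
    N≡∑∑χ u = trans (sum-map-allFin (λ s → ListAction.sum (map (λ t → χ s t u) (allFin n))))
                    (sum-cong-≗ (λ s → sum-map-allFin (λ t → χ s t u)))

    ∑χ : ∀ s t → ∑[ u < n ] χ s t u ≡ 𝟙 (lookup S s) * 𝟙 (lookup T t)
    ∑χ s t = begin
      ∑[ u < n ] χ s t u
        ≡⟨ ∑-𝟙-∧ (lookup S s) (λ u → lookup T t ∧ ⌊ (s · t) ≟ u ⌋) ⟩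
      𝟙 (lookup S s) * ∑[ u < n ] 𝟙 (lookup T t ∧ ⌊ (s · t) ≟ u ⌋)
        ≡⟨ cong (𝟙 (lookup S s) *_) (∑-𝟙-∧ (lookup T t) (λ u → ⌊ (s · t) ≟ u ⌋)) ⟩
      𝟙 (lookup S s) * (𝟙 (lookup T t) * ∑[ u < n ] 𝟙 ⌊ (s · t) ≟ u ⌋)
        ≡⟨ cong (λ k → 𝟙 (lookup S s) * (𝟙 (lookup T t) * k)) (∑-𝟙-≟ (s · t)) ⟩
      𝟙 (lookup S s) * (𝟙 (lookup T t) * 1)
        ≡⟨ cong (𝟙 (lookup S s) *_) (*-identityʳ _) ⟩
      𝟙 (lookup S s) * 𝟙 (lookup T t)
        ∎

  ∑-N≡∣S∣*∣T∣ : ∑[ u < n ] N _·_ 0# -_ S T u ≡ ∣ S ∣ * ∣ T ∣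
  ∑-N≡∣S∣*∣T∣ = begin
    ∑[ u < n ] N _·_ 0# -_ S T u
      ≡⟨ sum-cong-≗ N≡∑∑χ ⟩
    ∑[ u < n ] ∑[ s < n ] ∑[ t < n ] χ s t u
      ≡⟨ ∑-comm (λ s u → ∑[ t < n ] χ s t u) ⟨
    ∑[ s < n ] ∑[ u < n ] ∑[ t < n ] χ s t u
      ≡⟨ sum-cong-≗ (λ s → ∑-comm (λ u t → χ s t u)) ⟩
    ∑[ s < n ] ∑[ t < n ] ∑[ u < n ] χ s t u
      ≡⟨ sum-cong-≗ (λ s → sum-cong-≗ (∑χ s)) ⟩
    ∑[ s < n ] ∑[ t < n ] (𝟙 (lookup S s) * 𝟙 (lookup T t))
      ≡⟨ ∑*∑ (λ s → 𝟙 (lookup S s)) (λ t → 𝟙 (lookup T t)) ⟨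
    (∑[ s < n ] 𝟙 (lookup S s)) * (∑[ t < n ] 𝟙 (lookup T t))
      ≡⟨ cong₂ _*_ (∣∣≡∑𝟙 S) (∣∣≡∑𝟙 T) ⟨
    ∣ S ∣ * ∣ T ∣
      ∎

  N≤1⇒∣S∣*∣T∣≤n : (∀ u → N _·_ 0# -_ S T u ≤ 1) → ∣ S ∣ * ∣ T ∣ ≤ n
  N≤1⇒∣S∣*∣T∣≤n N≤1 = subst₂ _≤_ ∑-N≡∣S∣*∣T∣ (*-identityʳ n) (∑-bounded N≤1)

n<[1+⌊√n⌋]² : ∀ n → n < suc ⌊√ n ⌋ * suc ⌊√ n ⌋
n<[1+⌊√n⌋]² zero = s≤s z≤n
n<[1+⌊√n⌋]² (suc n) with ⌊√ n ⌋ | n<[1+⌊√n⌋]² n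
... | r | n<[1+r]² with suc r * suc r ≤ᵇ suc n in eq
...   | true  = ≤-trans (s≤s n<[1+r]²) (*-mono-< (n<1+n (suc r)) (n<1+n (suc r)))
...   | false = ≰⇒> (λ [1+r]²≤1+n → subst T eq (≤⇒≤ᵇ [1+r]²≤1+n))

k*k≤n⇒k≤⌊√n⌋ : ∀ {n k} → k * k ≤ n → k ≤ ⌊√ n ⌋
k*k≤n⇒k≤⌊√n⌋ {n} {k} k*k≤n with k ≤? ⌊√ n ⌋
... | yes k≤⌊√n⌋ = k≤⌊√n⌋
... | no  k≰⌊√n⌋ = ⊥-elim (<⇒≱ (n<[1+⌊√n⌋]² n) (≤-trans (*-mono-≤ ⌊√n⌋<k ⌊√n⌋<k) k*k≤n))
  where ⌊√n⌋<k = ≰⇒> k≰⌊√n⌋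

mainTheorem13 : (n : ℕ) (_+_ : Op₂ (Fin n)) (0# : Fin n) (-_ : Op₁ (Fin n))
    → IsAbelianGroup _≡_ _+_ 0# -_
    → (d : ℕ) → Admissible _+_ 0# -_ d → d ≤ ⌊√ n ⌋
mainTheorem13 n _+_ 0# -_ _ d (S , T , _ , _ , _ , _ , ∣S∣≡d , ∣T∣≡d , N≤1) =
  k*k≤n⇒k≤⌊√n⌋ (subst₂ (λ a b → a * b ≤ n) ∣S∣≡d ∣T∣≡d (N≤1⇒∣S∣*∣T∣≤n _+_ 0# -_ S T N≤1))
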